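{- Let $A$ and $B$ be symbolic heaps of array separation logic, $$A=\Pi:\mathop{*}_{i=1}^n\mathsf{array}(a_i,b_i)*\mathop{*}_{i=1}^k t_i\mapsto u_i,\qquad B=\exists\vec z.\,\Pi':\mathop{*}_{j=1}^m\mathsf{array}(c_j,d_j)*\mathop{*}_{j=1}^{\ell}v_j\mapsto w_j,$$ where the variables $\vec z$ are disjoint from the variables of $A$ and no variable of $\vec z$ occurs among $w_1,\dots,w_\ell$ (the right-hand sides of $\mapsto$ formulas in $B$). Then for every stack $s$: $s\models\chi(A,B)$ if and only if there exists a heap $h$ with $s,h\models A$ and $s,h\not\models B$.
   Context: ASL: terms $t ::= x\mid n\mid t+t\mid n t$ ($x$ a variable, $n\in\mathbb{N}$); pure formulas are conjunctions of $t=t,t\neq t,t\le t,t<t$; spatial formulas $F::=\mathsf{emp}\mid t\mapsto t\mid\mathsf{array}(t,t)\mid F*F$; symbolic heaps $\exists\vec z.\,\Pi:F$, with $\mathrm{qf}(\exists\vec z.\,\Pi:F)=\Pi:F$. Stacks $s:\mathsf{Var}\to\mathbb{N}$, heaps finite partial maps $\mathbb{N}\rightharpoonup\mathbb{N}$, $h_1\circ h_2$ union of domain-disjoint heaps. $s,h\models\mathsf{emp}$ iff $h$ empty; $s,h\models t_1\mapsto t_2$ iff $\mathrm{dom}(h)=\{s(t_1)\}$ and $h(s(t_1))=s(t_2)$; $s,h\models\mathsf{array}(t_1,t_2)$ iff $s(t_1)\le s(t_2)$ and $\mathrm{dom}(h)=\{s(t_1),\dots,s(t_2)\}$; $s,h\models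 F_1*F_2$ iff $h=h_1\circ h_2$ with $s,h_i\models F_i$; existentials by choosing values. For quantifier-free $C$, $\lfloor C\rfloor$ replaces each $c\mapsto d$ by $\mathsf{array}(c,c)$; if $\lfloor C\rfloor=\Pi:\mathop{*}_{i=1}^N\mathsf{array}(\hat a_i,\hat b_i)$ then $\gamma(C)=\Pi\wedge\bigwedge_i\hat a_i\le\hat b_i\wedge\bigwedge_{i<j}((\hat b_i<\hat a_j)\vee(\hat b_j<\hat a_i))$. For symbolic heaps $C,D$ with $\lfloor\mathrm{qf}(C)\rfloor$, $\lfloor\mathrm{qf}(D)\rfloor$ having spatial parts $\mathop{*}_{i=1}^p\mathsf{array}(\alpha_i,\beta_i)$, $\mathop{*}_{j=1}^q\mathsf{array}(\gamma_j,\delta_j)$, let $\phi(C,D)=\exists x.\bigvee_{i=1}^p(\alpha_i\le x\le\beta_i)\wedge\bigwedge_{j=1}^q((x<\gamma_j)\vee(x>\delta_j))$ ($x$ fresh). Define $\psi_1(A,B)=\bigvee_{i=1}^n\bigvee_{j=1}^{\ell}a_i\le v_j\le b_i$, $\psi_2(A,B)=\bigvee_{i=1}^k\bigvee_{j=1}^{\ell}(t_i=v_j)\wedge(u_i\neq w_j)$, and $\chi(A,B)=\gamma(A)\wedge\forall\vec z.\big(\neg\gamma(\mathrm{qf}(B))\vee\phi(A,B)\vee\phi(B,A)\vee\psi_1(A,B)\vee\psi_2(A,B)\big)$, interpreted in Presburger arithmetic over $\mathbb{N}$. -}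

module Defs where

open import Data.Nat using (ℕ; _+_; _*_; _≤_; _<_; _>_)
open import Data.List using (List; []; _∷_; _++_; map; concatMap)
open import Data.List.Membership.Propositional using (_∈_; _∉_)
open import Data.List.Relation.Unary.All using (All)
open import Data.List.Relation.Unary.Any using (Any)
open import Data.List.Relation.Unary.AllPairs using (AllPairs)
open import Data.Maybe using (Maybe; just; nothing)
open import Data.Product using (_×_; _,_; ∃; Σ; proj₁; proj₂)
open import Data.Sum using (_⊎_)
open import Relation.Binary.PropositionalEquality using (_≡_; _≢_)
open import Relation.Nullary using (¬_)

Var : Set
Var = ℕ

data Term : Set where
  var  : Var → Term
  num  : ℕ → Term
  _⊕_  : Term → Term → Term
  _⊛_  : ℕ → Term → Term

-- pure atoms; a pure formula is a (possibly empty) conjunction = list of atoms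
data Atom : Set where
  _≐_  : Term → Term → Atom
  _≠̇_  : Term → Term → Atom
  _≤̇_  : Term → Term → Atom
  _<̇_  : Term → Term → Atom

Pure : Set
Pure = List Atom

data Spatial : Set where
  emp   : Spatial
  _↦_   : Term → Term → Spatial
  array : Term → Term → Spatial
  _✱_   : Spatial → Spatial → Spatial

record QF : Set where
  constructor ⟨_∣_∣_⟩
  field
    pure   : Pure
    arrays : List (Term × Term)
    ptos   : List (Term × Term)
open QF public

record SH : Set where
  constructor ∃[_]∙_
  field
    exVars : List Var
    body   : QF
open SH public

⊛-list : List Spatial → Spatial
⊛-list []       = emp
⊛-list (F ∷ Fs) = F ✱ ⊛-list Fs

spatialOf : QF → Spatial
spatialOf C = ⊛-list (map (λ p → array (proj₁ p) (proj₂ p)) (arrays C))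
           ✱ ⊛-list (map (λ p → proj₁ p ↦ proj₂ p) (ptos C))

varsT : Term → List Var
varsT (var x) = x ∷ []
varsT (num n) = []
varsT (t ⊕ u) = varsT t ++ varsT u
varsT (n ⊛ t) = varsT t

varsAtom : Atom → List Var
varsAtom (t ≐ u)  = varsT t ++ varsT u
varsAtom (t ≠̇ u) = varsT t ++ varsT u
varsAtom (t ≤̇ u) = varsT t ++ varsT u
varsAtom (t <̇ u) = varsT t ++ varsT u

varsPair : Term × Term → List Var
varsPair p = varsT (proj₁ p) ++ varsT (proj₂ p)

varsQF : QF → List Var
varsQF C = concatMap varsAtom (pure C) ++ concatMap varsPair (arrays C)
           ++ concatMap varsPair (ptos C)

Stack : Set
Stack = Var → ℕ

⟦_⟧ : Term → Stack → ℕ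
⟦ var x ⟧ s = s x
⟦ num n ⟧ s = n
⟦ t ⊕ u ⟧ s = ⟦ t ⟧ s + ⟦ u ⟧ s
⟦ n ⊛ t ⟧ s = n * ⟦ t ⟧ s

record Heap : Set where
  field
    at     : ℕ → Maybe ℕ
    finite : ∃ λ N → ∀ x → N ≤ x → at x ≡ nothing
open Heap public

_∈dom_ : ℕ → Heap → Set
x ∈dom h = ∃ λ v → at h x ≡ just v

-- h = h₁ ∘ h₂ (union of domain-disjoint heaps)
_≔_∘_ : Heap → Heap → Heap → Set
h ≔ h₁ ∘ h₂ = ∀ x → (at h₁ x ≡ nothing × at h x ≡ at h₂ x)
                  ⊎ (at h₂ x ≡ nothing × at h x ≡ at h₁ x)

_⊨ₐ_ : Stack → Atom → Set
s ⊨ₐ (t ≐ u)  = ⟦ t ⟧ s ≡ ⟦ u ⟧ s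
s ⊨ₐ (t ≠̇ u) = ⟦ t ⟧ s ≢ ⟦ u ⟧ s
s ⊨ₐ (t ≤̇ u) = ⟦ t ⟧ s ≤ ⟦ u ⟧ s
s ⊨ₐ (t <̇ u) = ⟦ t ⟧ s < ⟦ u ⟧ s

_⊨ₚ_ : Stack → Pure → Set
s ⊨ₚ Π = All (s ⊨ₐ_) Π

_,_⊨ₛ_ : Stack → Heap → Spatial → Set
s , h ⊨ₛ emp = ∀ x → at h x ≡ nothing
s , h ⊨ₛ (t₁ ↦ t₂) = at h (⟦ t₁ ⟧ s) ≡ just (⟦ t₂ ⟧ s)
                     × (∀ x → x ≢ ⟦ t₁ ⟧ s → at h x ≡ nothing)
s , h ⊨ₛ array t₁ t₂ = ⟦ t₁ ⟧ s ≤ ⟦ t₂ ⟧ s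
                     × (∀ x → (x ∈dom h → ⟦ t₁ ⟧ s ≤ x × x ≤ ⟦ t₂ ⟧ s)
                            × (⟦ t₁ ⟧ s ≤ x × x ≤ ⟦ t₂ ⟧ s → x ∈dom h))
s , h ⊨ₛ (F₁ ✱ F₂) = ∃ λ h₁ → ∃ λ h₂ → h ≔ h₁ ∘ h₂ × s , h₁ ⊨ₛ F₁ × s , h₂ ⊨ₛ F₂

_,_⊨q_ : Stack → Heap → QF → Set
s , h ⊨q C = s ⊨ₚ pure C × s , h ⊨ₛ spatialOf C

AgreeOutside : List Var → Stack → Stack → Set
AgreeOutside zs s s' = ∀ x → x ∉ zs → s' x ≡ s x

_,_⊨_ : Stack → Heap → SH → Set
s , h ⊨ B = ∃ λ s' → AgreeOutside (exVars B) s s' × s' , h ⊨q body B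

-- The Presburger formulas γ, φ, ψ₁, ψ₂, χ (given by their meaning at a stack)

floorArrays : QF → List (Term × Term)
floorArrays C = arrays C ++ map (λ p → (proj₁ p , proj₁ p)) (ptos C)

γ : QF → Stack → Set
γ C s = s ⊨ₚ pure C
      × All (λ p → ⟦ proj₁ p ⟧ s ≤ ⟦ proj₂ p ⟧ s) (floorArrays C)
      × AllPairs (λ p q → ⟦ proj₂ p ⟧ s < ⟦ proj₁ q ⟧ s ⊎ ⟦ proj₂ q ⟧ s < ⟦ proj₁ p ⟧ s)
                 (floorArrays C)

φ : QF → QF → Stack → Set
φ C D s = ∃ λ x → Any (λ p → ⟦ proj₁ p ⟧ s ≤ x × x ≤ ⟦ proj₂ p ⟧ s) (floorArrays C)
                × All (λ q → x < ⟦ proj₁ q ⟧ s ⊎ x > ⟦ proj₂ q ⟧ s) (floorArrays D)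

ψ₁ : QF → QF → Stack → Set
ψ₁ A B s = Any (λ ab → Any (λ vw → ⟦ proj₁ ab ⟧ s ≤ ⟦ proj₁ vw ⟧ s
                                  × ⟦ proj₁ vw ⟧ s ≤ ⟦ proj₂ ab ⟧ s) (ptos B)) (arrays A)

ψ₂ : QF → QF → Stack → Set
ψ₂ A B s = Any (λ tu → Any (λ vw → ⟦ proj₁ tu ⟧ s ≡ ⟦ proj₁ vw ⟧ s
                                  × ⟦ proj₂ tu ⟧ s ≢ ⟦ proj₂ vw ⟧ s) (ptos B)) (ptos A)

_⊨χ[_,_] : Stack → QF → SH → Set
s ⊨χ[ A , B ] = γ A s
  × (∀ s' → AgreeOutside (exVars B) s s' →
        ¬ γ (body B) s' ⊎ φ A (body B) s' ⊎ φ (body B) A s'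
        ⊎ ψ₁ A (body B) s' ⊎ ψ₂ A (body B) s')

-- A heap satisfies the spatial part of a quantifier-free symbolic heap C exactly when its
-- domain is the union of the intervals of ⌊C⌋ under the stack, these intervals are proper
-- and pairwise disjoint (the spatial part of γ(C)), and the points-to cells of C hold the
-- prescribed values. So a model h of A fails B for a choice of z⃗ satisfying γ(qf B) iff
-- the two families of intervals cover different sets (φ(A,B) or φ(B,A)), or they cover the
-- same set but some cell v_j ↦ w_j of B lies in an array of A (ψ₁) or on a pointer
-- t_i ↦ u_i of A with u_i ≠ w_j (ψ₂).
--
-- For the countermodel fill the arrays of A with a value larger than every w_j; as z⃗ does
-- not occur in the w_j this choice works for all z⃗ at once, and then ψ₁ really refutes B.
-- Conversely, if for some z⃗ none of the conditions holds, every model of A is a model of B;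
-- the conditions are decidable, which yields the disjunction that χ demands constructively.

module Submission where

open import Defs
open import Data.Empty using (⊥; ⊥-elim)
open import Data.List using (List; []; _∷_; _++_; map; concatMap)
open import Data.List.Extrema.Nat using (max; xs≤max)
open import Data.List.Membership.Propositional using (_∈_; _∉_; find; lose)
open import Data.List.Membership.Propositional.Properties using (∈-map⁺; ∈-++⁺ˡ; ∈-++⁺ʳ)
open import Data.List.Properties using (map-++; map-∘)
open import Data.List.Relation.Unary.All as All using (All; []; _∷_)
import Data.List.Relation.Unary.All.Properties as AllP
open import Data.List.Relation.Unary.AllPairs as AllPairs using (AllPairs; []; _∷_)
import Data.List.Relation.Unary.AllPairs.Properties as AllPairsP
open import Data.List.Relation.Unary.Any as Any using (Any; here; there)
import Data.List.Relation.Unary.Any.Properties as AnyP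
open import Data.Maybe using (Maybe; just; nothing)
open import Data.Maybe.Properties using (just-injective)
open import Data.Nat using (ℕ; suc; _+_; _*_; _≤_; _<_; _>_; _⊔_; _≤?_; _<?_; _≟_; s≤s)
open import Data.Nat.Properties
  using (≤-refl; ≤-trans; ≤-antisym; ≤-reflexive; <⇒≱; ≰⇒>; ≮⇒≥; <-irrefl; m≤m⊔n; m≤n⊔m; ⊔-lub; anyUpTo?)
open import Data.Product using (_×_; _,_; ∃; proj₁; proj₂)
open import Data.Product using () renaming (map₂ to Σ-map₂)
open import Data.Sum using (_⊎_; inj₁; inj₂; [_,_]′)
open import Function using (_∘_; id)
open import Function.Bundles using (_⇔_; mk⇔; Equivalence)
open import Relation.Binary.PropositionalEquality
  using (_≡_; _≢_; refl; sym; trans; cong; cong₂; subst; subst₂)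
open import Relation.Nullary using (¬_; Dec; yes; no; ¬?)
open import Relation.Nullary.Decidable using (_×-dec_; _⊎-dec_; map′; decidable-stable; toSum)
open import Relation.Unary using (Decidable)
open import Relation.Unary.Properties using (∁?)

open Equivalence using (to; from)

private
  variable
    a b : ℕ
    x v f : ℕ
    h h₁ h₂ : Heap
    m : Maybe ℕ
    s s′ : Stack

AllPairs-++⁻ : ∀ {A : Set} {R : A → A → Set} xs {ys} → AllPairs R (xs ++ ys)
             → AllPairs R xs × AllPairs R ys × All (λ x → All (R x) ys) xs
AllPairs-++⁻ []       Rys           = [] , Rys , []
AllPairs-++⁻ (x ∷ xs) (Rx ∷ Rxsys) with AllPairs-++⁻ xs Rxsys
... | Rxs , Rys , Rxsys′ = AllP.++⁻ˡ xs Rx ∷ Rxs , Rys , AllP.++⁻ʳ xs Rx ∷ Rxsys′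

-- Stated for the value m = at h x rather than for h: Heap is a record with η, so h
-- cannot be inferred from at h x.
∈dom-nothing : (∃ λ v → m ≡ just v) → m ≡ nothing → ⊥
∈dom-nothing (_ , refl) ()

¬∈dom⇒nothing : ¬ (∃ λ v → m ≡ just v) → m ≡ nothing
¬∈dom⇒nothing {nothing} _   = refl
¬∈dom⇒nothing {just v} x∉h = ⊥-elim (x∉h (v , refl))

module Composition {h h₁ h₂ : Heap} (split : h ≔ h₁ ∘ h₂) where

  ∘-dom⁻ : x ∈dom h → x ∈dom h₁ ⊎ x ∈dom h₂
  ∘-dom⁻ {x} (v , eq) with split x
  ... | inj₁ (_ , at≡at₂) = inj₂ (v , trans (sym at≡at₂) eq)
  ... | inj₂ (_ , at≡at₁) = inj₁ (v , trans (sym at≡at₁) eq)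

  ∘-atˡ : at h₁ x ≡ just v → at h x ≡ just v
  ∘-atˡ {x} eq with split x
  ... | inj₁ (at₁≡nothing , _) = ⊥-elim (∈dom-nothing (_ , eq) at₁≡nothing)
  ... | inj₂ (_ , at≡at₁)      = trans at≡at₁ eq

  ∘-atʳ : at h₂ x ≡ just v → at h x ≡ just v
  ∘-atʳ {x} eq with split x
  ... | inj₁ (_ , at≡at₂)      = trans at≡at₂ eq
  ... | inj₂ (at₂≡nothing , _) = ⊥-elim (∈dom-nothing (_ , eq) at₂≡nothing)

  ∘-disjoint : x ∈dom h₁ → x ∈dom h₂ → ⊥
  ∘-disjoint {x} x∈h₁ x∈h₂ with split x
  ... | inj₁ (at₁≡nothing , _) = ∈dom-nothing x∈h₁ at₁≡nothing
  ... | inj₂ (at₂≡nothing , _) = ∈dom-nothing x∈h₂ at₂≡nothing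

restrict : Heap → {S : ℕ → Set} → Decidable S → Heap
restrict h {S} S? = record { at = restricted ; finite = proj₁ (finite h) , bounded }
  where
  restricted : ℕ → Maybe ℕ
  restricted x with S? x
  ... | yes _ = at h x
  ... | no _  = nothing

  bounded : ∀ x → proj₁ (finite h) ≤ x → restricted x ≡ nothing
  bounded x N≤x with S? x
  ... | yes _ = proj₂ (finite h) x N≤x
  ... | no _  = refl

module _ (h : Heap) {S : ℕ → Set} (S? : Decidable S) where

  at-restrict-∈ : S x → at (restrict h S?) x ≡ at h x
  at-restrict-∈ {x} x∈S with S? x
  ... | yes _   = refl
  ... | no x∉S = ⊥-elim (x∉S x∈S)

  at-restrict-∉ : ¬ S x → at (restrict h S?) x ≡ nothing
  at-restrict-∉ {x} x∉S with S? x
  ... | yes x∈S = ⊥-elim (x∉S x∈S)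
  ... | no _    = refl

  restrict-dom⁺ : S x → x ∈dom h → x ∈dom restrict h S?
  restrict-dom⁺ x∈S = Σ-map₂ (trans (at-restrict-∈ x∈S))

  restrict-dom⁻ : ∀ x → x ∈dom restrict h S? → S x × x ∈dom h
  restrict-dom⁻ x (v , eq) with S? x
  ... | yes x∈S = x∈S , (v , eq)
  ... | no _ with eq
  ...   | ()

restrict-∘ : ∀ h {S} (S? : Decidable S) → h ≔ restrict h S? ∘ restrict h (∁? S?)
restrict-∘ h S? x =
  [ (λ x∈S → inj₂ (at-restrict-∉ h (∁? S?) (λ x∉S → x∉S x∈S) , sym (at-restrict-∈ h S? x∈S)))
  , (λ x∉S → inj₁ (at-restrict-∉ h S? x∉S , sym (at-restrict-∈ h (∁? S?) x∉S)))
  ]′ (toSum (S? x))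

-- Closed intervals of addresses

Interval : Set
Interval = ℕ × ℕ

-- (address , content)
Cell : Set
Cell = ℕ × ℕ

private
  variable
    i j : Interval
    I J Iₐ Jₐ I₁ I₂ : List Interval
    P Q P₁ P₂ : List Cell

infix 4 _∈ᵢ_ _∉ᵢ_ _∈⋃_ _∈⋃?_

_∈ᵢ_ : ℕ → Interval → Set
x ∈ᵢ (a , b) = a ≤ x × x ≤ b

_∉ᵢ_ : ℕ → Interval → Set
x ∉ᵢ (a , b) = x < a ⊎ x > b

_∈⋃_ : ℕ → List Interval → Set
x ∈⋃ I = Any (x ∈ᵢ_) I

Proper : Interval → Set
Proper (a , b) = a ≤ b

Disjoint : Interval → Interval → Set
Disjoint (a , b) (c , d) = b < c ⊎ d < a

WellShaped : List Interval → Set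
WellShaped I = All Proper I × AllPairs Disjoint I

cellIntervals : List Cell → List Interval
cellIntervals = map (λ (a , _) → a , a)

Covers : List Interval → List Cell → Set
Covers I P = All (λ (a , _) → a ∈⋃ I) P

top : List Interval → ℕ
top I = max 0 (map proj₂ I)

∈ᵢ-point⁺ : x ≡ a → x ∈ᵢ (a , a)
∈ᵢ-point⁺ refl = ≤-refl , ≤-refl

∈ᵢ-point⁻ : x ∈ᵢ (a , a) → x ≡ a
∈ᵢ-point⁻ (a≤x , x≤a) = ≤-antisym x≤a a≤x

∉ᵢ⇒¬∈ᵢ : x ∉ᵢ i → ¬ x ∈ᵢ i
∉ᵢ⇒¬∈ᵢ (inj₁ x<a) (a≤x , _) = <⇒≱ x<a a≤x
∉ᵢ⇒¬∈ᵢ (inj₂ x>b) (_ , x≤b) = <⇒≱ x>b x≤b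

¬∈ᵢ⇒∉ᵢ : ¬ x ∈ᵢ i → x ∉ᵢ i
¬∈ᵢ⇒∉ᵢ {x} {a , b} x∉i with a ≤? x
... | no a≰x  = inj₁ (≰⇒> a≰x)
... | yes a≤x = inj₂ (≰⇒> (λ x≤b → x∉i (a≤x , x≤b)))

all-∉ᵢ⇒∉⋃ : All (x ∉ᵢ_) I → ¬ x ∈⋃ I
all-∉ᵢ⇒∉⋃ = AllP.All¬⇒¬Any ∘ All.map ∉ᵢ⇒¬∈ᵢ

∉⋃⇒all-∉ᵢ : ¬ x ∈⋃ I → All (x ∉ᵢ_) I
∉⋃⇒all-∉ᵢ = All.map ¬∈ᵢ⇒∉ᵢ ∘ AllP.¬Any⇒All¬ _

_∈⋃?_ : ∀ x I → Dec (x ∈⋃ I)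
x ∈⋃? I = Any.any? (λ (a , b) → (a ≤? x) ×-dec (x ≤? b)) I

∈⋃⇒≤top : x ∈⋃ I → x ≤ top I
∈⋃⇒≤top {I = I} x∈I with find x∈I
... | _ , i∈I , (_ , x≤b) = ≤-trans x≤b (All.lookup (xs≤max 0 (map proj₂ I)) (∈-map⁺ proj₂ i∈I))

∈⋃-cellIntervals⁺ : ∀ {c} → c ∈ P → proj₁ c ∈⋃ cellIntervals P
∈⋃-cellIntervals⁺ c∈P = AnyP.map⁺ (lose c∈P (∈ᵢ-point⁺ refl))

∈⋃-cellIntervals⁻ : x ∈⋃ cellIntervals P → Any (λ (a , _) → a ≡ x) P
∈⋃-cellIntervals⁻ = Any.map (sym ∘ ∈ᵢ-point⁻) ∘ AnyP.map⁻

cellIntervals-covers : Covers (cellIntervals P) P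
cellIntervals-covers = All.tabulate ∈⋃-cellIntervals⁺

disjoint⇒¬shared : Disjoint i j → x ∈ᵢ i → x ∈ᵢ j → ⊥
disjoint⇒¬shared (inj₁ b<c) (_ , x≤b) (c≤x , _) = <⇒≱ b<c (≤-trans c≤x x≤b)
disjoint⇒¬shared (inj₂ d<a) (a≤x , _) (_ , x≤d) = <⇒≱ d<a (≤-trans a≤x x≤d)

-- If neither interval ends before the other starts, the larger left end is shared.
disjoint-or-shared : Proper i → Proper j → Disjoint i j ⊎ ∃ λ x → x ∈ᵢ i × x ∈ᵢ j
disjoint-or-shared {a , b} {c , d} a≤b c≤d with b <? c | d <? a
... | yes b<c | _       = inj₁ (inj₁ b<c)
... | no _    | yes d<a = inj₁ (inj₂ d<a)
... | no b≮c  | no d≮a  =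
  inj₂ (a ⊔ c , (m≤m⊔n a c , ⊔-lub a≤b (≮⇒≥ b≮c)) , (m≤n⊔m a c , ⊔-lub (≮⇒≥ d≮a) c≤d))

⋃-disjoint : All (λ i → All (Disjoint i) J) I → x ∈⋃ I → x ∈⋃ J → ⊥
⋃-disjoint I⊥J x∈I x∈J with find x∈I | find x∈J
... | _ , i∈I , x∈i | _ , j∈J , x∈j = disjoint⇒¬shared (All.lookup (All.lookup I⊥J i∈I) j∈J) x∈i x∈j

record Layout (I : List Interval) (P : List Cell) (h : Heap) : Set where
  field
    wellShaped : WellShaped I
    dom⊆⋃      : x ∈dom h → x ∈⋃ I
    ⋃⊆dom      : x ∈⋃ I → x ∈dom h
    stores     : All (λ (a , v) → at h a ≡ just v) P
open Layout

∘-layout : h ≔ h₁ ∘ h₂ → Layout I₁ P₁ h₁ → Layout I₂ P₂ h₂ → Layout (I₁ ++ I₂) (P₁ ++ P₂) h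
∘-layout {h} {h₁} {h₂} {I₁} {P₁} {I₂} {P₂} split L₁ L₂ = record
  { wellShaped = AllP.++⁺ (proj₁ (wellShaped L₁)) (proj₁ (wellShaped L₂))
               , AllPairsP.++⁺ (proj₂ (wellShaped L₁)) (proj₂ (wellShaped L₂))
                               (All.tabulate λ i∈ → All.tabulate λ j∈ → apart i∈ j∈)
  ; dom⊆⋃      = [ AnyP.++⁺ˡ ∘ dom⊆⋃ L₁ , AnyP.++⁺ʳ I₁ ∘ dom⊆⋃ L₂ ]′ ∘ ∘-dom⁻
  ; ⋃⊆dom      = [ Σ-map₂ ∘-atˡ ∘ ⋃⊆dom L₁ , Σ-map₂ ∘-atʳ ∘ ⋃⊆dom L₂ ]′ ∘ AnyP.++⁻ I₁
  ; stores     = AllP.++⁺ (All.map ∘-atˡ (stores L₁)) (All.map ∘-atʳ (stores L₂))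
  }
  where
  open Composition {h} {h₁} {h₂} split

  apart : i ∈ I₁ → j ∈ I₂ → Disjoint i j
  apart i∈ j∈ with disjoint-or-shared (All.lookup (proj₁ (wellShaped L₁)) i∈)
                                      (All.lookup (proj₁ (wellShaped L₂)) j∈)
  ... | inj₁ disjoint          = disjoint
  ... | inj₂ (_ , x∈i , x∈j) =
    ⊥-elim (∘-disjoint (⋃⊆dom L₁ (lose i∈ x∈i)) (⋃⊆dom L₂ (lose j∈ x∈j)))

restrict-layoutˡ : Covers I₁ P₁ → Layout (I₁ ++ I₂) (P₁ ++ P₂) h
                 → Layout I₁ P₁ (restrict h (_∈⋃? I₁))
restrict-layoutˡ {I₁} {P₁} {h = h} covers L = record
  { wellShaped = AllP.++⁻ˡ I₁ (proj₁ (wellShaped L)) , proj₁ (AllPairs-++⁻ I₁ (proj₂ (wellShaped L)))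
  ; dom⊆⋃      = λ {x} → proj₁ ∘ restrict-dom⁻ h (_∈⋃? I₁) x
  ; ⋃⊆dom      = λ x∈I₁ → restrict-dom⁺ h (_∈⋃? I₁) x∈I₁ (⋃⊆dom L (AnyP.++⁺ˡ x∈I₁))
  ; stores     = All.tabulate λ c∈ →
      trans (at-restrict-∈ h (_∈⋃? I₁) (All.lookup covers c∈))
            (All.lookup (AllP.++⁻ˡ P₁ (stores L)) c∈)
  }

restrict-layoutʳ : Covers I₂ P₂ → Layout (I₁ ++ I₂) (P₁ ++ P₂) h
                 → Layout I₂ P₂ (restrict h (∁? (_∈⋃? I₁)))
restrict-layoutʳ {I₂} {P₂} {I₁} {P₁} {h} covers L = record
  { wellShaped = AllP.++⁻ʳ I₁ (proj₁ (wellShaped L)) , proj₁ (proj₂ shapes)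
  ; dom⊆⋃      = λ {x} x∈ → let x∉I₁ , x∈h = restrict-dom⁻ h outside? x x∈ in
                   [ ⊥-elim ∘ x∉I₁ , id ]′ (AnyP.++⁻ I₁ (dom⊆⋃ L x∈h))
  ; ⋃⊆dom      = λ x∈I₂ → restrict-dom⁺ h outside? (outside x∈I₂) (⋃⊆dom L (AnyP.++⁺ʳ I₁ x∈I₂))
  ; stores     = All.tabulate λ c∈ →
      trans (at-restrict-∈ h outside? (outside (All.lookup covers c∈)))
            (All.lookup (AllP.++⁻ʳ P₁ (stores L)) c∈)
  }
  where
  outside? : Decidable (λ x → ¬ x ∈⋃ I₁)
  outside? = ∁? (_∈⋃? I₁)

  shapes : AllPairs Disjoint I₁ × AllPairs Disjoint I₂ × All (λ i → All (Disjoint i) I₂) I₁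
  shapes = AllPairs-++⁻ I₁ (proj₂ (wellShaped L))

  outside : x ∈⋃ I₂ → ¬ x ∈⋃ I₁
  outside x∈I₂ x∈I₁ = ⋃-disjoint (proj₂ (proj₂ shapes)) x∈I₁ x∈I₂

-- Layouts of spatial formulas

record Characterises (s : Stack) (F : Spatial) (I : List Interval) (P : List Cell) : Set where
  field ⊨⇔layout : ∀ h → s , h ⊨ₛ F ⇔ Layout I P h
open Characterises

✱-characterises : ∀ {F₁ F₂} → Covers I₁ P₁ → Covers I₂ P₂
                → Characterises s F₁ I₁ P₁ → Characterises s F₂ I₂ P₂
                → Characterises s (F₁ ✱ F₂) (I₁ ++ I₂) (P₁ ++ P₂)
✱-characterises {I₁ = I₁} covers₁ covers₂ F₁ F₂ .⊨⇔layout h = mk⇔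
  (λ (h₁ , h₂ , split , ⊨F₁ , ⊨F₂) → ∘-layout split (to (⊨⇔layout F₁ h₁) ⊨F₁) (to (⊨⇔layout F₂ h₂) ⊨F₂))
  (λ L → _ , _ , restrict-∘ h (_∈⋃? I₁)
       , from (⊨⇔layout F₁ _) (restrict-layoutˡ covers₁ L)
       , from (⊨⇔layout F₂ _) (restrict-layoutʳ covers₂ L))

emp-characterises : Characterises s emp [] []
emp-characterises .⊨⇔layout h = mk⇔
  (λ ⊨emp → record
    { wellShaped = [] , []
    ; dom⊆⋃      = λ x∈ → ⊥-elim (∈dom-nothing x∈ (⊨emp _))
    ; ⋃⊆dom      = λ ()
    ; stores     = []
    })
  (λ L x → ¬∈dom⇒nothing (AnyP.¬Any[] ∘ dom⊆⋃ L))

array-characterises : ∀ t u → Characterises s (array t u) ((⟦ t ⟧ s , ⟦ u ⟧ s) ∷ []) []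
array-characterises t u .⊨⇔layout h = mk⇔
  (λ (t≤u , dom) → record
    { wellShaped = t≤u ∷ [] , [] ∷ []
    ; dom⊆⋃      = λ x∈ → here (proj₁ (dom _) x∈)
    ; ⋃⊆dom      = λ x∈ → proj₂ (dom _) (AnyP.singleton⁻ x∈)
    ; stores     = []
    })
  (λ L → All.head (proj₁ (wellShaped L)) , λ x → AnyP.singleton⁻ ∘ dom⊆⋃ L , ⋃⊆dom L ∘ here)

↦-characterises : ∀ t u → Characterises s (t ↦ u) ((⟦ t ⟧ s , ⟦ t ⟧ s) ∷ []) ((⟦ t ⟧ s , ⟦ u ⟧ s) ∷ [])
↦-characterises {s} t u .⊨⇔layout h = mk⇔
  (λ (stored , elsewhere) → record
    { wellShaped = ≤-refl ∷ [] , [] ∷ []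
    ; dom⊆⋃      = λ {x} x∈ → here (∈ᵢ-point⁺ (decidable-stable (x ≟ ⟦ t ⟧ s)
                                  (∈dom-nothing x∈ ∘ elsewhere x)))
    ; ⋃⊆dom      = λ x∈ → subst (_∈dom h) (sym (∈ᵢ-point⁻ (AnyP.singleton⁻ x∈))) (_ , stored)
    ; stores     = stored ∷ []
    })
  (λ L → All.head (stores L)
       , λ x x≢t → ¬∈dom⇒nothing (x≢t ∘ ∈ᵢ-point⁻ ∘ AnyP.singleton⁻ ∘ dom⊆⋃ L))

⟦_⟧ᴵ : List (Term × Term) → Stack → List (ℕ × ℕ)
⟦ L ⟧ᴵ s = map (λ p → ⟦ proj₁ p ⟧ s , ⟦ proj₂ p ⟧ s) L

⊛-arrays : List (Term × Term) → Spatial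
⊛-arrays L = ⊛-list (map (λ p → array (proj₁ p) (proj₂ p)) L)

⊛-ptos : List (Term × Term) → Spatial
⊛-ptos L = ⊛-list (map (λ p → proj₁ p ↦ proj₂ p) L)

arrays-characterise : ∀ L → Characterises s (⊛-arrays L) (⟦ L ⟧ᴵ s) []
arrays-characterise []            = emp-characterises
arrays-characterise ((t , u) ∷ L) =
  ✱-characterises [] [] (array-characterises t u) (arrays-characterise L)

ptos-characterise : ∀ L → Characterises s (⊛-ptos L) (cellIntervals (⟦ L ⟧ᴵ s)) (⟦ L ⟧ᴵ s)
ptos-characterise []            = emp-characterises
ptos-characterise ((t , u) ∷ L) =
  ✱-characterises cellIntervals-covers cellIntervals-covers
                  (↦-characterises t u) (ptos-characterise L)

footprint : QF → Stack → List Interval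
footprint C s = ⟦ arrays C ⟧ᴵ s ++ cellIntervals (⟦ ptos C ⟧ᴵ s)

spatial-characterises : ∀ C → Characterises s (spatialOf C) (footprint C s) (⟦ ptos C ⟧ᴵ s)
spatial-characterises C =
  ✱-characterises [] cellIntervals-covers
                  (arrays-characterise (arrays C)) (ptos-characterise (ptos C))

Escapes : List Interval → List Interval → Set
Escapes I J = ∃ λ x → x ∈⋃ I × All (x ∉ᵢ_) J

Hits : List Cell → List Interval → Set
Hits Q I = Any (λ (a , _) → a ∈⋃ I) Q

Clash : List Cell → List Cell → Set
Clash P Q = Any (λ (a , u) → Any (λ (b , w) → a ≡ b × u ≢ w) Q) P

layouts-⋃⊆ : Layout I P h → Layout J Q h → x ∈⋃ I → x ∈⋃ J
layouts-⋃⊆ L L′ = dom⊆⋃ L′ ∘ ⋃⊆dom L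

escapes⇒⊈ : Escapes I J → (∀ {x} → x ∈⋃ I → x ∈⋃ J) → ⊥
escapes⇒⊈ (_ , x∈I , x∉J) I⊆J = all-∉ᵢ⇒∉⋃ x∉J (I⊆J x∈I)

¬escapes⇒⊆ : ¬ Escapes I J → x ∈⋃ I → x ∈⋃ J
¬escapes⇒⊆ {J = J} {x} ¬escapes x∈I =
  decidable-stable (x ∈⋃? J) (λ x∉J → ¬escapes (x , x∈I , ∉⋃⇒all-∉ᵢ x∉J))

clash⇒¬layouts : Clash P Q → Layout I P h → Layout J Q h → ⊥
clash⇒¬layouts clash L L′ with find clash
... | _ , c∈P , clash′ with find clash′
...   | _ , d∈Q , (refl , u≢w) =
  u≢w (just-injective (trans (sym (All.lookup (stores L) c∈P)) (All.lookup (stores L′) d∈Q)))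

layout-transfer : WellShaped (Jₐ ++ cellIntervals Q)
                → ¬ Escapes (Iₐ ++ cellIntervals P) (Jₐ ++ cellIntervals Q)
                → ¬ Escapes (Jₐ ++ cellIntervals Q) (Iₐ ++ cellIntervals P)
                → ¬ Hits Q Iₐ → ¬ Clash P Q
                → Layout (Iₐ ++ cellIntervals P) P h → Layout (Jₐ ++ cellIntervals Q) Q h
layout-transfer {Jₐ} {Q} {Iₐ} {P} {h} shape ¬I⊈J ¬J⊈I ¬hits ¬clash L = record
  { wellShaped = shape
  ; dom⊆⋃      = ¬escapes⇒⊆ ¬I⊈J ∘ dom⊆⋃ L
  ; ⋃⊆dom      = ⋃⊆dom L ∘ ¬escapes⇒⊆ ¬J⊈I
  ; stores     = All.tabulate stored
  }
  where
  stored : ∀ {c} → c ∈ Q → at h (proj₁ c) ≡ just (proj₂ c)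
  stored {b , w} c∈Q with AnyP.++⁻ Iₐ (¬escapes⇒⊆ ¬J⊈I (AnyP.++⁺ʳ Jₐ (∈⋃-cellIntervals⁺ c∈Q)))
  ... | inj₁ b∈Iₐ = ⊥-elim (¬hits (lose c∈Q b∈Iₐ))
  ... | inj₂ b∈P with find (∈⋃-cellIntervals⁻ b∈P)
  ...   | (_ , u) , d∈P , refl = trans (All.lookup (stores L) d∈P) (cong just u≡w)
    where
    u≡w : u ≡ w
    u≡w = decidable-stable (u ≟ w) (λ u≢w → ¬clash (lose d∈P (lose c∈Q (refl , u≢w))))

-- The canonical heap of a layout

lookup : List Cell → ℕ → Maybe ℕ
lookup []            x = nothing
lookup ((a , v) ∷ P) x with a ≟ x
... | yes _ = just v
... | no _  = lookup P x

lookup-dom : lookup P x ≡ just v → x ∈⋃ cellIntervals P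
lookup-dom {(a , _) ∷ P} {x} eq with a ≟ x
... | yes a≡x = here (∈ᵢ-point⁺ (sym a≡x))
... | no _    = there (lookup-dom eq)

lookup-complete : x ∈⋃ cellIntervals P → ∃ λ v → lookup P x ≡ just v
lookup-complete {x} {(a , v) ∷ P} x∈ with a ≟ x | x∈
... | yes _   | _         = v , refl
... | no a≢x | here x∈a  = ⊥-elim (a≢x (sym (∈ᵢ-point⁻ x∈a)))
... | no _    | there x∈P = lookup-complete x∈P

lookup-skip : ∀ {u} → a ≢ x → lookup ((a , u) ∷ P) x ≡ lookup P x
lookup-skip {a} {x} a≢x with a ≟ x
... | yes a≡x = ⊥-elim (a≢x a≡x)
... | no _    = refl

lookup-head : ∀ {v} → lookup ((a , v) ∷ P) a ≡ just v
lookup-head {a} with a ≟ a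
... | yes _   = refl
... | no a≢a = ⊥-elim (a≢a refl)

lookup-stores : AllPairs Disjoint (cellIntervals P) → All (λ (a , v) → lookup P a ≡ just v) P
lookup-stores {[]}          []                 = []
lookup-stores {(a , v) ∷ P} (apart ∷ distinct) =
  lookup-head {a = a} {P = P} ∷ All.tabulate λ c∈P →
    trans (lookup-skip (distinct-addresses (All.lookup apart (∈-map⁺ _ c∈P))))
          (All.lookup (lookup-stores distinct) c∈P)
  where
  distinct-addresses : ∀ {b} → Disjoint (a , a) (b , b) → a ≢ b
  distinct-addresses apart′ a≡b = disjoint⇒¬shared apart′ (∈ᵢ-point⁺ refl) (∈ᵢ-point⁺ a≡b)

fillAt : ℕ → List Interval → List Cell → ℕ → Maybe ℕ
fillAt f I P x with x ∈⋃? I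
... | yes _ = just f
... | no _  = lookup P x

fillAt-dom : fillAt f I P x ≡ just v → x ∈⋃ I ++ cellIntervals P
fillAt-dom {f} {I} {P} {x} eq with x ∈⋃? I
... | yes x∈I = AnyP.++⁺ˡ x∈I
... | no _    = AnyP.++⁺ʳ I (lookup-dom eq)

fillHeap : ℕ → List Interval → List Cell → Heap
fillHeap f I P = record { at = fillAt f I P ; finite = suc (top (I ++ cellIntervals P)) , bounded }
  where
  bounded : ∀ x → suc (top (I ++ cellIntervals P)) ≤ x → fillAt f I P x ≡ nothing
  bounded x top<x with fillAt f I P x in eq
  ... | nothing = refl
  ... | just _  = ⊥-elim (<⇒≱ top<x (∈⋃⇒≤top (fillAt-dom {f = f} {I} {P} eq)))

fillHeap-∈ : x ∈⋃ I → at (fillHeap f I P) x ≡ just f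
fillHeap-∈ {x} {I} x∈I with x ∈⋃? I
... | yes _   = refl
... | no x∉I = ⊥-elim (x∉I x∈I)

fillHeap-∉ : ¬ x ∈⋃ I → at (fillHeap f I P) x ≡ lookup P x
fillHeap-∉ {x} {I} x∉I with x ∈⋃? I
... | yes x∈I = ⊥-elim (x∉I x∈I)
... | no _    = refl

fillHeap-layout : WellShaped (I ++ cellIntervals P) → Layout (I ++ cellIntervals P) P (fillHeap f I P)
fillHeap-layout {I} {P} {f} shape = record
  { wellShaped = shape
  ; dom⊆⋃      = λ (_ , eq) → fillAt-dom {f = f} {I} {P} eq
  ; ⋃⊆dom      = ⋃⊆dom′
  ; stores     = All.tabulate λ c∈P →
      trans (fillHeap-∉ (outside (∈⋃-cellIntervals⁺ c∈P))) (All.lookup (lookup-stores distinct) c∈P)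
  }
  where
  shapes : AllPairs Disjoint I × AllPairs Disjoint (cellIntervals P)
         × All (λ i → All (Disjoint i) (cellIntervals P)) I
  shapes = AllPairs-++⁻ I (proj₂ shape)

  distinct : AllPairs Disjoint (cellIntervals P)
  distinct = proj₁ (proj₂ shapes)

  outside : x ∈⋃ cellIntervals P → ¬ x ∈⋃ I
  outside x∈P x∈I = ⋃-disjoint (proj₂ (proj₂ shapes)) x∈I x∈P

  ⋃⊆dom′ : x ∈⋃ I ++ cellIntervals P → x ∈dom fillHeap f I P
  ⋃⊆dom′ x∈ with AnyP.++⁻ I x∈
  ... | inj₁ x∈I = f , fillHeap-∈ x∈I
  ... | inj₂ x∈P = Σ-map₂ (trans (fillHeap-∉ (outside x∈P))) (lookup-complete x∈P)

hits⇒¬fillHeap-layout : All (λ (_ , w) → w < f) Q → Hits Q I → Layout J Q (fillHeap f I P) → ⊥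
hits⇒¬fillHeap-layout below hits L with find hits
... | _ , c∈Q , a∈I =
  <-irrefl (just-injective (trans (sym (All.lookup (stores L) c∈Q)) (fillHeap-∈ a∈I)))
           (All.lookup below c∈Q)

atom? : ∀ s A → Dec (s ⊨ₐ A)
atom? s (t ≐ u)  = ⟦ t ⟧ s ≟ ⟦ u ⟧ s
atom? s (t ≠̇ u) = ¬? (⟦ t ⟧ s ≟ ⟦ u ⟧ s)
atom? s (t ≤̇ u) = ⟦ t ⟧ s ≤? ⟦ u ⟧ s
atom? s (t <̇ u) = ⟦ t ⟧ s <? ⟦ u ⟧ s

wellShaped? : ∀ I → Dec (WellShaped I)
wellShaped? I = All.all? (λ (a , b) → a ≤? b) I
         ×-dec AllPairs.allPairs? (λ (a , b) (c , d) → (b <? c) ⊎-dec (d <? a)) I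

-- The search is bounded because a witness lies in ⋃ I, hence below suc (top I).
escapes? : ∀ I J → Dec (Escapes I J)
escapes? I J = map′ (λ (x , _ , escapes) → x , escapes)
                    (λ (x , x∈I , x∉J) → x , s≤s (∈⋃⇒≤top x∈I) , x∈I , x∉J)
                    (anyUpTo? (λ x → (x ∈⋃? I) ×-dec All.all? (λ (a , b) → (x <? a) ⊎-dec (b <? x)) J)
                              (suc (top I)))

hits? : ∀ Q I → Dec (Hits Q I)
hits? Q I = Any.any? (λ (a , _) → a ∈⋃? I) Q

clash? : ∀ P Q → Dec (Clash P Q)
clash? P Q = Any.any? (λ (a , u) → Any.any? (λ (b , w) → (a ≟ b) ×-dec ¬? (u ≟ w)) Q) P

-- The formulas of χ in terms of layouts

⟦floorArrays⟧ᴵ : ∀ C s → ⟦ floorArrays C ⟧ᴵ s ≡ footprint C s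
⟦floorArrays⟧ᴵ C s =
  trans (map-++ _ (arrays C) _)
        (cong (⟦ arrays C ⟧ᴵ s ++_) (trans (sym (map-∘ (ptos C))) (map-∘ (ptos C))))

γ⇔ : ∀ C s → γ C s ⇔ (s ⊨ₚ pure C × WellShaped (footprint C s))
γ⇔ C s = mk⇔
  (λ (pureC , proper , disjoint) →
     pureC , subst WellShaped (⟦floorArrays⟧ᴵ C s) (AllP.map⁺ proper , AllPairsP.map⁺ disjoint))
  (λ (pureC , shape) → let proper , disjoint = subst WellShaped (sym (⟦floorArrays⟧ᴵ C s)) shape in
     pureC , AllP.map⁻ proper , AllPairsP.map⁻ disjoint)

φ⇔ : ∀ C D s → φ C D s ⇔ Escapes (footprint C s) (footprint D s)
φ⇔ C D s = mk⇔
  (λ (x , x∈C , x∉D) →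
     subst₂ Escapes (⟦floorArrays⟧ᴵ C s) (⟦floorArrays⟧ᴵ D s) (x , AnyP.map⁺ x∈C , AllP.map⁺ x∉D))
  (λ escapes →
     let x , x∈C , x∉D = subst₂ Escapes (sym (⟦floorArrays⟧ᴵ C s)) (sym (⟦floorArrays⟧ᴵ D s)) escapes in
     x , AnyP.map⁻ x∈C , AllP.map⁻ x∉D)

ψ₁⇔ : ∀ A B s → ψ₁ A B s ⇔ Hits (⟦ ptos B ⟧ᴵ s) (⟦ arrays A ⟧ᴵ s)
ψ₁⇔ A B s = mk⇔ (AnyP.map⁺ ∘ Any.map AnyP.map⁺ ∘ AnyP.swap)
                (AnyP.swap ∘ Any.map AnyP.map⁻ ∘ AnyP.map⁻)

ψ₂⇔ : ∀ A B s → ψ₂ A B s ⇔ Clash (⟦ ptos A ⟧ᴵ s) (⟦ ptos B ⟧ᴵ s)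
ψ₂⇔ A B s = mk⇔ (AnyP.map⁺ ∘ Any.map AnyP.map⁺) (Any.map AnyP.map⁻ ∘ AnyP.map⁻)

γ? : ∀ C s → Dec (γ C s)
γ? C s = map′ (from (γ⇔ C s)) (to (γ⇔ C s))
              (All.all? (atom? s) (pure C) ×-dec wellShaped? (footprint C s))

Refutation : QF → QF → Stack → Set
Refutation A C s = ¬ γ C s ⊎ φ A C s ⊎ φ C A s ⊎ ψ₁ A C s ⊎ ψ₂ A C s

refutation? : ∀ A C s → Dec (Refutation A C s)
refutation? A C s =
  ¬? (γ? C s)
  ⊎-dec map′ (from (φ⇔ A C s)) (to (φ⇔ A C s)) (escapes? (footprint A s) (footprint C s))
  ⊎-dec map′ (from (φ⇔ C A s)) (to (φ⇔ C A s)) (escapes? (footprint C s) (footprint A s))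
  ⊎-dec map′ (from (ψ₁⇔ A C s)) (to (ψ₁⇔ A C s)) (hits? (⟦ ptos C ⟧ᴵ s) (⟦ arrays A ⟧ᴵ s))
  ⊎-dec map′ (from (ψ₂⇔ A C s)) (to (ψ₂⇔ A C s)) (clash? (⟦ ptos A ⟧ᴵ s) (⟦ ptos C ⟧ᴵ s))

⟦⟧-local : ∀ t → (∀ {y} → y ∈ varsT t → s′ y ≡ s y) → ⟦ t ⟧ s′ ≡ ⟦ t ⟧ s
⟦⟧-local (var x) agree = agree (here refl)
⟦⟧-local (num n) agree = refl
⟦⟧-local (t ⊕ u) agree =
  cong₂ _+_ (⟦⟧-local t (agree ∘ ∈-++⁺ˡ)) (⟦⟧-local u (agree ∘ ∈-++⁺ʳ (varsT t)))
⟦⟧-local (n ⊛ t) agree = cong (n *_) (⟦⟧-local t agree)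

⟦⟧ᴵ-local : ∀ L → (∀ {y} → y ∈ concatMap varsPair L → s′ y ≡ s y) → ⟦ L ⟧ᴵ s′ ≡ ⟦ L ⟧ᴵ s
⟦⟧ᴵ-local []            agree = refl
⟦⟧ᴵ-local ((t , u) ∷ L) agree =
  cong₂ _∷_ (cong₂ _,_ (⟦⟧-local t (agree ∘ ∈-++⁺ˡ ∘ ∈-++⁺ˡ))
                       (⟦⟧-local u (agree ∘ ∈-++⁺ˡ ∘ ∈-++⁺ʳ (varsT t))))
            (⟦⟧ᴵ-local L (agree ∘ ∈-++⁺ʳ (varsPair (t , u))))

module _ (A : QF) (B : SH)
         (fresh-A : ∀ z → z ∈ exVars B → z ∉ varsQF A)
         (fresh-w : ∀ z → z ∈ exVars B → ∀ w → w ∈ map proj₂ (ptos (body B)) → z ∉ varsT w)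
         (s : Stack) where

  module _ {s′ : Stack} (agree : AgreeOutside (exVars B) s s′) where

    arrays-A-local : ⟦ arrays A ⟧ᴵ s′ ≡ ⟦ arrays A ⟧ᴵ s
    arrays-A-local = ⟦⟧ᴵ-local (arrays A) λ y∈ →
      agree _ (λ y∈zs → fresh-A _ y∈zs (∈-++⁺ʳ (concatMap varsAtom (pure A)) (∈-++⁺ˡ y∈)))

    ptos-A-local : ⟦ ptos A ⟧ᴵ s′ ≡ ⟦ ptos A ⟧ᴵ s
    ptos-A-local = ⟦⟧ᴵ-local (ptos A) λ y∈ →
      agree _ (λ y∈zs → fresh-A _ y∈zs
        (∈-++⁺ʳ (concatMap varsAtom (pure A)) (∈-++⁺ʳ (concatMap varsPair (arrays A)) y∈)))

    layout-A-local : Layout (footprint A s) (⟦ ptos A ⟧ᴵ s) h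
                   → Layout (footprint A s′) (⟦ ptos A ⟧ᴵ s′) h
    layout-A-local {h} =
      subst₂ (λ I P → Layout (I ++ cellIntervals P) P h) (sym arrays-A-local) (sym ptos-A-local)

    value-B-local : ∀ {r} → r ∈ ptos (body B) → ⟦ proj₂ r ⟧ s′ ≡ ⟦ proj₂ r ⟧ s
    value-B-local {r} r∈ = ⟦⟧-local (proj₂ r) λ y∈ →
      agree _ (λ y∈zs → fresh-w _ y∈zs _ (∈-map⁺ proj₂ r∈) y∈)

  fill : ℕ
  fill = suc (max 0 (map (λ r → ⟦ proj₂ r ⟧ s) (ptos (body B))))

  below-fill : AgreeOutside (exVars B) s s′ → All (λ (_ , w) → w < fill) (⟦ ptos (body B) ⟧ᴵ s′)
  below-fill agree = AllP.map⁺ (All.tabulate λ r∈ →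
    s≤s (≤-trans (≤-reflexive (value-B-local agree r∈)) (All.lookup (xs≤max 0 _) (∈-map⁺ _ r∈))))

  countermodel : Heap
  countermodel = fillHeap fill (⟦ arrays A ⟧ᴵ s) (⟦ ptos A ⟧ᴵ s)

  χ⇒countermodel : s ⊨χ[ A , B ] → ∃ λ h → (s , h ⊨q A) × ¬ (s , h ⊨ B)
  χ⇒countermodel (γA , refutes) =
    countermodel , (pureA , from (⊨⇔layout (spatial-characterises A) countermodel) LA) , ¬⊨B
    where
    pureA : s ⊨ₚ pure A
    pureA = proj₁ (to (γ⇔ A s) γA)

    LA : Layout (footprint A s) (⟦ ptos A ⟧ᴵ s) countermodel
    LA = fillHeap-layout (proj₂ (to (γ⇔ A s) γA))

    ¬⊨B : ¬ (s , countermodel ⊨ B)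
    ¬⊨B (s′ , agree , pureB , ⊨B) = refuted (refutes s′ agree)
      where
      LA′ : Layout (footprint A s′) (⟦ ptos A ⟧ᴵ s′) countermodel
      LA′ = layout-A-local agree LA

      LB : Layout (footprint (body B) s′) (⟦ ptos (body B) ⟧ᴵ s′) countermodel
      LB = to (⊨⇔layout (spatial-characterises (body B)) countermodel) ⊨B

      refuted : ¬ Refutation A (body B) s′
      refuted (inj₁ ¬γB)                      = ¬γB (from (γ⇔ (body B) s′) (pureB , wellShaped LB))
      refuted (inj₂ (inj₁ φAB))               = escapes⇒⊈ (to (φ⇔ A (body B) s′) φAB) (layouts-⋃⊆ LA′ LB)
      refuted (inj₂ (inj₂ (inj₁ φBA)))        = escapes⇒⊈ (to (φ⇔ (body B) A s′) φBA) (layouts-⋃⊆ LB LA′)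
      refuted (inj₂ (inj₂ (inj₂ (inj₁ ψ₁AB)))) =
        hits⇒¬fillHeap-layout (below-fill agree)
          (subst (Hits _) (arrays-A-local agree) (to (ψ₁⇔ A (body B) s′) ψ₁AB)) LB
      refuted (inj₂ (inj₂ (inj₂ (inj₂ ψ₂AB)))) = clash⇒¬layouts (to (ψ₂⇔ A (body B) s′) ψ₂AB) LA′ LB

  countermodel⇒χ : (∃ λ h → (s , h ⊨q A) × ¬ (s , h ⊨ B)) → s ⊨χ[ A , B ]
  countermodel⇒χ (h , (pureA , ⊨A) , ¬⊨B) = from (γ⇔ A s) (pureA , wellShaped LA) , refutes
    where
    LA : Layout (footprint A s) (⟦ ptos A ⟧ᴵ s) h
    LA = to (⊨⇔layout (spatial-characterises A) h) ⊨A

    refutes : ∀ s′ → AgreeOutside (exVars B) s s′ → Refutation A (body B) s′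
    refutes s′ agree = decidable-stable (refutation? A (body B) s′) λ ¬refuted →
      let pureB , shapeB = to (γ⇔ (body B) s′) (decidable-stable (γ? (body B) s′) (¬refuted ∘ inj₁)) in
      ¬⊨B (s′ , agree , pureB , from (⊨⇔layout (spatial-characterises (body B)) h)
        (layout-transfer shapeB
          (¬refuted ∘ inj₂ ∘ inj₁ ∘ from (φ⇔ A (body B) s′))
          (¬refuted ∘ inj₂ ∘ inj₂ ∘ inj₁ ∘ from (φ⇔ (body B) A s′))
          (¬refuted ∘ inj₂ ∘ inj₂ ∘ inj₂ ∘ inj₁ ∘ from (ψ₁⇔ A (body B) s′))
          (¬refuted ∘ inj₂ ∘ inj₂ ∘ inj₂ ∘ inj₂ ∘ from (ψ₂⇔ A (body B) s′))
          (layout-A-local agree LA)))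

lemma43 : (A : QF) (B : SH)
    → (∀ z → z ∈ exVars B → z ∉ varsQF A)
    → (∀ z → z ∈ exVars B → ∀ w → w ∈ map proj₂ (ptos (body B)) → z ∉ varsT w)
    → (s : Stack)
    → (s ⊨χ[ A , B ]) ⇔ (∃ λ (h : Heap) → (s , h ⊨q A) × ¬ (s , h ⊨ B))
lemma43 A B fresh-A fresh-w s =
  mk⇔ (χ⇒countermodel A B fresh-A fresh-w s) (countermodel⇒χ A B fresh-A fresh-w s)
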